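{- Let $h\geq 1$ be an integer and let $A$ be a finite set of $k$ integers containing both positive and negative integers. Then \[|h_{\pm}A| \geq hk-h+1.\] This lower bound is best possible: for every odd integer $k\geq 3$, the set $A=\{ -\tfrac{k-1}{2},\ldots,-1,0,1,\ldots,\tfrac{k-1}{2}\}$ satisfies $|h_{\pm}A|=hk-h+1$.
   Context: For a finite set $A=\{a_0,a_1,\ldots,a_{k-1}\}$ of integers and a positive integer $h$, the $h$-fold signed sumset of $A$ is \[h_{\pm}A=\Big\{\sum_{i=0}^{k-1}\lambda_i a_i : (\lambda_0,\ldots,\lambda_{k-1})\in\mathbb{Z}^k,\ \sum_{i=0}^{k-1}|\lambda_i|=h\Big\}.\] -}

module Defs where

open import Data.Nat using (ℕ; zero; suc)
open import Data.Integer using (ℤ; +_; _+_; _*_; _-_; ∣_∣)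
open import Data.Fin using (Fin; zero; suc; toℕ)
open import Data.List using (List; length)
open import Data.List.Membership.Propositional using (_∈_)
open import Data.List.Relation.Unary.Unique.Propositional using (Unique)
open import Data.Product using (Σ; _×_; ∃)
open import Function.Bundles using (_⇔_)
open import Relation.Binary.PropositionalEquality using (_≡_)

∑ : {k : ℕ} → (Fin k → ℤ) → ℤ
∑ {zero}  f = + 0
∑ {suc k} f = f zero + ∑ (λ i → f (suc i))

∑ℕ : {k : ℕ} → (Fin k → ℕ) → ℕ
∑ℕ {zero}  f = 0
∑ℕ {suc k} f = f zero Data.Nat.+ ∑ℕ (λ i → f (suc i))

-- h-fold signed sumset of A = {a_0,…,a_{k-1}} (given as an indexing Fin k → ℤ),
-- as a predicate on ℤ
SignedSumset : (h : ℕ) {k : ℕ} → (Fin k → ℤ) → ℤ → Set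
SignedSumset h {k} a x =
  Σ (Fin k → ℤ) λ c → (∑ℕ (λ i → ∣ c i ∣) ≡ h) × (∑ (λ i → c i * a i) ≡ x)

HasSize : (ℤ → Set) → ℕ → Set
HasSize S n = Σ (List ℤ) λ L → Unique L × (length L ≡ n) × (∀ x → (x ∈ L) ⇔ S x)

symInterval : (m : ℕ) → Fin (suc (m Data.Nat.+ m)) → ℤ
symInterval m i = + toℕ i - + m

{-# OPTIONS --safe #-}
module Submission where

-- Sort the elements as y₀ < y₁ < ⋯ < y_{k−1}. The sums (h − j) yᵢ + j yᵢ₊₁ with 0 ≤ j < h,
-- followed by h y_{k−1}, strictly increase, so they are hk − h + 1 distinct elements of the
-- ordinary sumset hA ⊆ h±A; of the sign hypotheses only k ≥ 1 is used. The signed sumset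
-- is finite, being a decidable subset of [−hM, hM] with M = Σ |aᵢ|. For A = [−m, m] it lies
-- in [−hm, hm], which has exactly 2hm + 1 = hk − h + 1 elements, so the bound is attained.

module SignedSumsets where

  open import Defs
  open import Data.Nat as ℕ using (ℕ; zero; suc; z≤n; s≤s; _∸_)
  import Data.Nat.Properties as ℕP
  import Data.Nat.Tactic.RingSolver as ℕ-Solver
  open import Data.Integer as ℤ using (ℤ; +_; -[1+_]; ∣_∣; _+_; _*_; _-_; _≤_; _<_)
  import Data.Integer.Properties as ℤP
  open import Data.Integer.Tactic.RingSolver using (solve-∀)
  open import Data.Fin using (Fin; zero; suc; toℕ)
  import Data.Fin.Properties as Fin
  import Data.Vec.Functional as Vector
  open import Data.Product using (Σ; _×_; ∃; _,_; proj₂)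
  open import Data.Sum using (inj₁; inj₂)
  open import Data.Empty using (⊥)
  open import Data.List using (List; []; _∷_; _++_; length; map; filter; applyUpTo; allFin)
  open import Data.List.Properties
    using (length-++; length-++-sucʳ; length-map; length-applyUpTo; length-tabulate; filter-notAll)
  open import Data.List.Membership.Propositional using (_∈_; find; lose)
  open import Data.List.Membership.Propositional.Properties
    using (∈-∃++; ∈-++⁻; ∈-++⁺ˡ; ∈-++⁺ʳ; ∈-filter⁻; ∈-filter⁺; ∈-map⁻)
  import Data.List.Relation.Unary.Unique.Propositional.Properties as Unique
  open import Data.List.Relation.Unary.Linked using (Linked; []; [-]; _∷_)
  open import Data.List.Relation.Binary.Permutation.Propositional using (↭-sym; ↭⇒↭ₛ)
  open import Data.List.Relation.Binary.Permutation.Propositional.Properties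
    using (∈-resp-↭; ↭-length)
  import Data.List.Relation.Binary.Permutation.Setoid.Properties as Permutation
  import Data.List.Sort
  open import Data.List.Relation.Unary.Any using (Any; here; there; any?)
  open import Data.List.Relation.Unary.All as All using (All; []; _∷_)
  import Data.List.Relation.Unary.All.Properties as AllP
  open import Data.List.Relation.Unary.AllPairs using ([]; _∷_)
  open import Data.List.Relation.Unary.Unique.Propositional using (Unique)
  open import Function.Bundles using (_⇔_; mk⇔; Equivalence)
  open import Function.Definitions using (Injective)
  import Function.Properties.Equivalence as ⇔
  open import Relation.Nullary using (yes; no; contradiction)
  open import Relation.Nullary.Decidable as Dec using (_×-dec_)
  open import Relation.Unary using (Decidable)
  open import Relation.Binary.PropositionalEquality

  ∑-cong : ∀ {k} {f g : Fin k → ℤ} → (∀ i → f i ≡ g i) → ∑ f ≡ ∑ g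
  ∑-cong {zero}  f≡g = refl
  ∑-cong {suc k} f≡g = cong₂ _+_ (f≡g zero) (∑-cong (λ i → f≡g (suc i)))

  ∑-+ : ∀ {k} (f g : Fin k → ℤ) → ∑ (λ i → f i + g i) ≡ ∑ f + ∑ g
  ∑-+ {zero}  f g = refl
  ∑-+ {suc k} f g = begin
    (f zero + g zero) + ∑ (λ i → f (suc i) + g (suc i))
      ≡⟨ cong (λ z → (f zero + g zero) + z) (∑-+ (λ i → f (suc i)) (λ i → g (suc i))) ⟩
    (f zero + g zero) + (∑ (λ i → f (suc i)) + ∑ (λ i → g (suc i)))
      ≡⟨ interchange (f zero) (g zero) _ _ ⟩
    (f zero + ∑ (λ i → f (suc i))) + (g zero + ∑ (λ i → g (suc i))) ∎
    where
    open ≡-Reasoning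
    interchange : ∀ a b c d → (a + b) + (c + d) ≡ (a + c) + (b + d)
    interchange = solve-∀

  ∑ℕ-+ : ∀ {k} (f g : Fin k → ℕ) → ∑ℕ (λ i → f i ℕ.+ g i) ≡ ∑ℕ f ℕ.+ ∑ℕ g
  ∑ℕ-+ {zero}  f g = refl
  ∑ℕ-+ {suc k} f g = begin
    (f zero ℕ.+ g zero) ℕ.+ ∑ℕ (λ i → f (suc i) ℕ.+ g (suc i))
      ≡⟨ cong ((f zero ℕ.+ g zero) ℕ.+_) (∑ℕ-+ (λ i → f (suc i)) (λ i → g (suc i))) ⟩
    (f zero ℕ.+ g zero) ℕ.+ (∑ℕ (λ i → f (suc i)) ℕ.+ ∑ℕ (λ i → g (suc i)))
      ≡⟨ interchange (f zero) (g zero) _ _ ⟩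
    (f zero ℕ.+ ∑ℕ (λ i → f (suc i))) ℕ.+ (g zero ℕ.+ ∑ℕ (λ i → g (suc i))) ∎
    where
    open ≡-Reasoning
    interchange : ∀ a b c d → (a ℕ.+ b) ℕ.+ (c ℕ.+ d) ≡ (a ℕ.+ c) ℕ.+ (b ℕ.+ d)
    interchange = ℕ-Solver.solve-∀

  ∑-zero : ∀ k → ∑ {k} (λ _ → + 0) ≡ + 0
  ∑-zero zero    = refl
  ∑-zero (suc k) = trans (ℤP.+-identityˡ _) (∑-zero k)

  ∑ℕ-zero : ∀ k → ∑ℕ {k} (λ _ → 0) ≡ 0
  ∑ℕ-zero zero    = refl
  ∑ℕ-zero (suc k) = ∑ℕ-zero k

  pointMass : ∀ {k} → Fin k → ℕ → Fin k → ℕ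
  pointMass zero    n zero    = n
  pointMass zero    n (suc i) = 0
  pointMass (suc p) n zero    = 0
  pointMass (suc p) n (suc i) = pointMass p n i

  ∑ℕ-pointMass : ∀ {k} (p : Fin k) n → ∑ℕ (pointMass p n) ≡ n
  ∑ℕ-pointMass {suc k} zero    n = trans (cong (n ℕ.+_) (∑ℕ-zero k)) (ℕP.+-identityʳ n)
  ∑ℕ-pointMass {suc k} (suc p) n = ∑ℕ-pointMass p n

  ∑-pointMass-* : ∀ {k} (p : Fin k) n (a : Fin k → ℤ) →
                  ∑ (λ i → + pointMass p n i * a i) ≡ + n * a p
  ∑-pointMass-* {suc k} zero    n a =
    trans (cong (λ z → + n * a zero + z) (∑-zero k)) (ℤP.+-identityʳ _)
  ∑-pointMass-* {suc k} (suc p) n a =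
    trans (ℤP.+-identityˡ _) (∑-pointMass-* p n (λ i → a (suc i)))

  ∣a∣≤∑ℕ∣a∣ : ∀ {k} (a : Fin k → ℤ) i → ∣ a i ∣ ℕ.≤ ∑ℕ (λ j → ∣ a j ∣)
  ∣a∣≤∑ℕ∣a∣ a zero    = ℕP.m≤m+n _ _
  ∣a∣≤∑ℕ∣a∣ a (suc i) = ℕP.≤-trans (∣a∣≤∑ℕ∣a∣ (λ j → a (suc j)) i) (ℕP.m≤n+m _ _)

  ∣∑∣≤ : ∀ {k} (M : ℕ) (a : Fin k → ℤ) → (∀ i → ∣ a i ∣ ℕ.≤ M) → (c : Fin k → ℤ) →
         ∣ ∑ (λ i → c i * a i) ∣ ℕ.≤ M ℕ.* ∑ℕ (λ i → ∣ c i ∣)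
  ∣∑∣≤ {zero}  M a a≤M c = z≤n
  ∣∑∣≤ {suc k} M a a≤M c = begin
    ∣ c zero * a zero + S ∣              ≤⟨ ℤP.∣i+j∣≤∣i∣+∣j∣ (c zero * a zero) S ⟩
    ∣ c zero * a zero ∣ ℕ.+ ∣ S ∣        ≤⟨ ℕP.+-mono-≤ head≤ tail≤ ⟩
    M ℕ.* ∣ c zero ∣ ℕ.+ M ℕ.* T         ≡⟨ ℕP.*-distribˡ-+ M ∣ c zero ∣ T ⟨
    M ℕ.* (∣ c zero ∣ ℕ.+ T)             ∎
    where
    open ℕP.≤-Reasoning
    S = ∑ (λ i → c (suc i) * a (suc i))
    T = ∑ℕ (λ i → ∣ c (suc i) ∣)
    head≤ : ∣ c zero * a zero ∣ ℕ.≤ M ℕ.* ∣ c zero ∣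
    head≤ = begin
      ∣ c zero * a zero ∣        ≡⟨ ℤP.abs-* (c zero) (a zero) ⟩
      ∣ c zero ∣ ℕ.* ∣ a zero ∣  ≤⟨ ℕP.*-monoʳ-≤ ∣ c zero ∣ (a≤M zero) ⟩
      ∣ c zero ∣ ℕ.* M           ≡⟨ ℕP.*-comm ∣ c zero ∣ M ⟩
      M ℕ.* ∣ c zero ∣           ∎
    tail≤ : ∣ S ∣ ℕ.≤ M ℕ.* T
    tail≤ = ∣∑∣≤ M (λ i → a (suc i)) (λ i → a≤M (suc i)) (λ i → c (suc i))

  SignedSumset-bounded : ∀ {h k} (M : ℕ) (a : Fin k → ℤ) → (∀ i → ∣ a i ∣ ℕ.≤ M) →
                         ∀ {x} → SignedSumset h a x → ∣ x ∣ ℕ.≤ h ℕ.* M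
  SignedSumset-bounded {h} M a a≤M (c , refl , refl) =
    ℕP.≤-trans (∣∑∣≤ M a a≤M c) (ℕP.≤-reflexive (ℕP.*-comm M h))

  Sumset : (h : ℕ) {k : ℕ} → (Fin k → ℤ) → ℤ → Set
  Sumset h {k} a x = Σ (Fin k → ℕ) λ c → (∑ℕ c ≡ h) × (∑ (λ i → + c i * a i) ≡ x)

  Sumset⇒SignedSumset : ∀ {h k} {a : Fin k → ℤ} {x} → Sumset h a x → SignedSumset h a x
  Sumset⇒SignedSumset (c , ∑c≡h , ∑ca≡x) = (λ i → + c i) , ∑c≡h , ∑ca≡x

  Sumset-+ : ∀ {h h′ k} (a : Fin k → ℤ) {x y} →
             Sumset h a x → Sumset h′ a y → Sumset (h ℕ.+ h′) a (x + y)
  Sumset-+ a (c , refl , refl) (d , refl , refl) =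
    (λ i → c i ℕ.+ d i) , ∑ℕ-+ c d ,
    trans (∑-cong distrib) (∑-+ (λ i → + c i * a i) (λ i → + d i * a i))
    where
    distrib : ∀ i → + (c i ℕ.+ d i) * a i ≡ + c i * a i + + d i * a i
    distrib i = trans (cong (_* a i) (ℤP.pos-+ (c i) (d i)))
                      (ℤP.*-distribʳ-+ (a i) (+ c i) (+ d i))

  Sumset-multiple : ∀ {k} (a : Fin k → ℤ) p n → Sumset n a (+ n * a p)
  Sumset-multiple a p n = pointMass p n , ∑ℕ-pointMass p n , ∑-pointMass-* p n a

  Sumset-segment : ∀ {h k} (a : Fin k → ℤ) p q {j} → j ℕ.≤ h →
                   Sumset h a (+ h * a p + + j * (a q - a p))
  Sumset-segment {h} a p q {j} j≤h =
    subst₂ (λ n x → Sumset n a x) h∸j+j≡h value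
      (Sumset-+ a (Sumset-multiple a p (h ∸ j)) (Sumset-multiple a q j))
    where
    open ≡-Reasoning
    h∸j+j≡h : h ∸ j ℕ.+ j ≡ h
    h∸j+j≡h = ℕP.m∸n+n≡m j≤h
    regroup : ∀ m n x y → m * x + n * y ≡ (m + n) * x + n * (y - x)
    regroup = solve-∀
    value : + (h ∸ j) * a p + + j * a q ≡ + h * a p + + j * (a q - a p)
    value = begin
      + (h ∸ j) * a p + + j * a q
        ≡⟨ regroup (+ (h ∸ j)) (+ j) (a p) (a q) ⟩
      (+ (h ∸ j) + + j) * a p + + j * (a q - a p)
        ≡⟨ cong (λ m → m * a p + + j * (a q - a p)) (ℤP.pos-+ (h ∸ j) j) ⟨
      + (h ∸ j ℕ.+ j) * a p + + j * (a q - a p)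
        ≡⟨ cong (λ n → + n * a p + + j * (a q - a p)) h∸j+j≡h ⟩
      + h * a p + + j * (a q - a p)                ∎

  symRange : ℕ → List ℤ
  symRange zero    = + 0 ∷ []
  symRange (suc N) = -[1+ N ] ∷ + suc N ∷ symRange N

  length-symRange : ∀ N → length (symRange N) ≡ suc (N ℕ.+ N)
  length-symRange zero    = refl
  length-symRange (suc N) =
    cong (λ n → suc (suc n)) (trans (length-symRange N) (sym (ℕP.+-suc N N)))

  ∈-symRange⁻ : ∀ N {x} → x ∈ symRange N → ∣ x ∣ ℕ.≤ N
  ∈-symRange⁻ zero    (here refl)             = z≤n
  ∈-symRange⁻ (suc N) (here refl)             = ℕP.≤-refl
  ∈-symRange⁻ (suc N) (there (here refl))     = ℕP.≤-refl
  ∈-symRange⁻ (suc N) (there (there x∈range)) = ℕP.m≤n⇒m≤1+n (∈-symRange⁻ N x∈range)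

  ∈-symRange⁺ : ∀ N {x} → ∣ x ∣ ℕ.≤ N → x ∈ symRange N
  ∈-symRange⁺ zero    {+ zero}    z≤n = here refl
  ∈-symRange⁺ (suc N) {+ n}       n≤N with ℕP.m≤n⇒m<n∨m≡n n≤N
  ... | inj₁ (s≤s n≤N′) = there (there (∈-symRange⁺ N n≤N′))
  ... | inj₂ refl       = there (here refl)
  ∈-symRange⁺ (suc N) { -[1+ n ]} n<N with ℕP.m≤n⇒m<n∨m≡n n<N
  ... | inj₁ (s≤s n<N′) = there (there (∈-symRange⁺ N n<N′))
  ... | inj₂ refl       = here refl

  symRange-unique : ∀ N → Unique (symRange N)
  symRange-unique zero    = [] ∷ []
  symRange-unique (suc N) =
    ((λ ()) ∷ All.tabulate (outside refl)) ∷ All.tabulate (outside refl) ∷ symRange-unique N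
    where
    outside : ∀ {x} → ∣ x ∣ ≡ suc N → ∀ {y} → y ∈ symRange N → x ≢ y
    outside ∣x∣≡1+N y∈range refl = ℕP.<-irrefl ∣x∣≡1+N (s≤s (∈-symRange⁻ N y∈range))

  SignedSumset-∷⇔ : ∀ {h k} (a : Fin (suc k) → ℤ) x →
    SignedSumset h a x ⇔
    Any (λ c₀ → SignedSumset (h ∸ ∣ c₀ ∣) (Vector.tail a) (x - c₀ * a zero)) (symRange h)
  SignedSumset-∷⇔ {h} a x = mk⇔ split join
    where
    cancel : ∀ u s → s ≡ (u + s) - u
    cancel = solve-∀
    uncancel : ∀ u x → u + (x - u) ≡ x
    uncancel = solve-∀
    split : SignedSumset h a x →
            Any (λ c₀ → SignedSumset (h ∸ ∣ c₀ ∣) (Vector.tail a) (x - c₀ * a zero)) (symRange h)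
    split (c , refl , refl) =
      lose {x = c zero} (∈-symRange⁺ _ (ℕP.m≤m+n ∣ c zero ∣ _))
           (Vector.tail c , sym (ℕP.m+n∸m≡n ∣ c zero ∣ _) , cancel (c zero * a zero) _)
    join : Any (λ c₀ → SignedSumset (h ∸ ∣ c₀ ∣) (Vector.tail a) (x - c₀ * a zero)) (symRange h) →
           SignedSumset h a x
    join c₀∈range with find c₀∈range
    ... | c₀ , c₀∈ , c , ∑c≡ , ∑ca≡ =
      c₀ Vector.∷ c ,
      trans (cong (∣ c₀ ∣ ℕ.+_) ∑c≡) (ℕP.m+[n∸m]≡n (∈-symRange⁻ h c₀∈)) ,
      trans (cong (λ s → c₀ * a zero + s) ∑ca≡) (uncancel (c₀ * a zero) x)

  SignedSumset? : ∀ h {k} (a : Fin k → ℤ) → Decidable (SignedSumset h a)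
  SignedSumset? h {zero} a x =
    Dec.map′ (λ { (∑≡h , ∑≡x) → (λ ()) , ∑≡h , ∑≡x }) (λ { (_ , ∑≡h , ∑≡x) → ∑≡h , ∑≡x })
             (0 ℕP.≟ h ×-dec + 0 ℤP.≟ x)
  SignedSumset? h {suc k} a x =
    Dec.map (⇔.sym (SignedSumset-∷⇔ a x))
      (any? (λ c₀ → SignedSumset? (h ∸ ∣ c₀ ∣) (Vector.tail a) (x - c₀ * a zero)) (symRange h))

  Unique⇒length≤ : ∀ {A : Set} {xs ys : List A} → Unique xs → (∀ {x} → x ∈ xs → x ∈ ys) →
                   length xs ℕ.≤ length ys
  Unique⇒length≤ {xs = []}     _                  _     = z≤n
  Unique⇒length≤ {xs = x ∷ xs} (x∉xs ∷ xs-unique) xs⊆ys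
    with us , vs , refl ← ∈-∃++ (xs⊆ys (here refl)) =
    ℕP.≤-trans (s≤s (Unique⇒length≤ xs-unique xs⊆us++vs))
               (ℕP.≤-reflexive (sym (length-++-sucʳ us x vs)))
    where
    xs⊆us++vs : ∀ {y} → y ∈ xs → y ∈ us ++ vs
    xs⊆us++vs y∈xs with ∈-++⁻ us (xs⊆ys (there y∈xs))
    ... | inj₁ y∈us          = ∈-++⁺ˡ y∈us
    ... | inj₂ (here refl)   = contradiction refl (All.lookup x∉xs y∈xs)
    ... | inj₂ (there y∈vs)  = ∈-++⁺ʳ us y∈vs

  HasSize⇒length≤ : ∀ {P : ℤ → Set} {n L} → HasSize P n → Unique L → All P L → length L ℕ.≤ n
  HasSize⇒length≤ (D , _ , refl , D⇔P) L-unique L⊆P =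
    Unique⇒length≤ L-unique (λ x∈L → Equivalence.from (D⇔P _) (All.lookup L⊆P x∈L))

  HasSize-filter : ∀ {P : ℤ → Set} (P? : Decidable P) {xs} → Unique xs → (∀ {x} → P x → x ∈ xs) →
                   HasSize P (length (filter P? xs))
  HasSize-filter P? {xs} xs-unique P⊆xs =
    filter P? xs , Unique.filter⁺ P? xs-unique , refl ,
    λ x → mk⇔ (λ x∈D → proj₂ (∈-filter⁻ P? {xs = xs} x∈D)) (λ px → ∈-filter⁺ P? (P⊆xs px) px)

  HasSize-saturated : ∀ {P : ℤ → Set} (P? : Decidable P) {xs L} → Unique xs →
                      (∀ {x} → P x → x ∈ xs) → Unique L → All P L → length xs ℕ.≤ length L →
                      HasSize P (length xs)
  HasSize-saturated {P} P? {xs} xs-unique P⊆xs L-unique L⊆P xs≤L =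
    xs , xs-unique , refl , λ x → mk⇔ xs⊆P P⊆xs
    where
    xs≤filter : length xs ℕ.≤ length (filter P? xs)
    xs≤filter = ℕP.≤-trans xs≤L (HasSize⇒length≤ (HasSize-filter P? xs-unique P⊆xs) L-unique L⊆P)
    xs⊆P : ∀ {x} → x ∈ xs → P x
    xs⊆P {x} x∈xs with P? x
    ... | yes px = px
    ... | no ¬px = contradiction (filter-notAll P? xs (lose x∈xs ¬px)) (ℕP.≤⇒≯ xs≤filter)

  InImage : ∀ {k} → (Fin k → ℤ) → ℤ → Set
  InImage a y = ∃ λ p → a p ≡ y

  module Segment (h : ℕ) {y y′ : ℤ} (y<y′ : y < y′) where

    point : ℕ → ℤ
    point j = + h * y + + j * (y′ - y)

    points : List ℤ
    points = applyUpTo point h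

    point-strictMono : ∀ {i j} → i ℕ.< j → point i < point j
    point-strictMono i<j =
      ℤP.+-monoʳ-< (+ h * y) (ℤP.*-monoʳ-<-pos (y′ - y) {{gap-positive}} (ℤ.+<+ i<j))
      where
      gap-positive : ℤ.Positive (y′ - y)
      gap-positive = ℤ.positive (subst (_< y′ - y) (ℤP.+-inverseʳ y) (ℤP.+-monoˡ-< (ℤ.- y) y<y′))

    point-zero : point 0 ≡ + h * y
    point-zero = ℤP.+-identityʳ (+ h * y)

    point-h : point h ≡ + h * y′
    point-h = telescope (+ h) y y′
      where
      telescope : ∀ n y y′ → n * y + n * (y′ - y) ≡ n * y′
      telescope = solve-∀

    points-unique : Unique points
    points-unique = Unique.applyUpTo⁺₁ point h (λ i<j _ → ℤP.<⇒≢ (point-strictMono i<j))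

    points-≥ : All (+ h * y ≤_) points
    points-≥ = AllP.applyUpTo⁺₂ point h above
      where
      above : ∀ j → + h * y ≤ point j
      above zero    = ℤP.≤-reflexive (sym point-zero)
      above (suc j) =
        ℤP.<⇒≤ (subst (_< point (suc j)) point-zero (point-strictMono {0} {suc j} (s≤s z≤n)))

    points-< : All (_< + h * y′) points
    points-< =
      AllP.applyUpTo⁺₁ point h (λ {j} j<h → subst (point j <_) point-h (point-strictMono j<h))

    points-⊆-Sumset : ∀ {k} (a : Fin k → ℤ) → InImage a y → InImage a y′ → All (Sumset h a) points
    points-⊆-Sumset a (p , refl) (q , refl) =
      AllP.applyUpTo⁺₁ point h (λ j<h → Sumset-segment a p q (ℕP.<⇒≤ j<h))

  sumsetChain : ∀ h {k} (a : Fin k → ℤ) y ys → Linked _<_ (y ∷ ys) → All (InImage a) (y ∷ ys) →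
                Σ (List ℤ) λ L → Unique L × (length L ≡ h ℕ.* length ys ℕ.+ 1) ×
                                 All (+ h * y ≤_) L × All (Sumset h a) L
  sumsetChain h a y [] _ ((p , refl) ∷ []) =
    + h * a p ∷ [] , [] ∷ [] , sym (cong (ℕ._+ 1) (ℕP.*-zeroʳ h)) ,
    ℤP.≤-refl ∷ [] , Sumset-multiple a p h ∷ []
  sumsetChain h a y (y′ ∷ ys) (y<y′ ∷ sorted) (y∈a ∷ y′∈a ∷ ys⊆a)
    with L , L-unique , L-length , L-≥ , L⊆Sumset ← sumsetChain h a y′ ys sorted (y′∈a ∷ ys⊆a) =
    points ++ L ,
    Unique.++⁺ points-unique L-unique disjoint ,
    length-points++L ,
    AllP.++⁺ points-≥ (All.map (ℤP.≤-trans hy≤hy′) L-≥) ,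
    AllP.++⁺ (points-⊆-Sumset a y∈a y′∈a) L⊆Sumset
    where
    open Segment h y<y′
    hy≤hy′ : + h * y ≤ + h * y′
    hy≤hy′ = ℤP.*-monoˡ-≤-nonNeg (+ h) (ℤP.<⇒≤ y<y′)
    disjoint : ∀ {x} → x ∈ points × x ∈ L → ⊥
    disjoint (x∈points , x∈L) = ℤP.<⇒≱ (All.lookup points-< x∈points) (All.lookup L-≥ x∈L)
    length-points++L : length (points ++ L) ≡ h ℕ.* suc (length ys) ℕ.+ 1
    length-points++L = begin
      length (points ++ L)                   ≡⟨ length-++ points ⟩
      length points ℕ.+ length L             ≡⟨ cong₂ ℕ._+_ (length-applyUpTo point h) L-length ⟩
      h ℕ.+ (h ℕ.* length ys ℕ.+ 1)          ≡⟨ ℕP.+-assoc h _ 1 ⟨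
      h ℕ.+ h ℕ.* length ys ℕ.+ 1            ≡⟨ cong (ℕ._+ 1) (ℕP.*-suc h (length ys)) ⟨
      h ℕ.* suc (length ys) ℕ.+ 1            ∎
      where open ≡-Reasoning

  Linked-≤∧Unique⇒Linked-< : ∀ {xs} → Linked _≤_ xs → Unique xs → Linked _<_ xs
  Linked-≤∧Unique⇒Linked-< []        _                       = []
  Linked-≤∧Unique⇒Linked-< [-]       _                       = [-]
  Linked-≤∧Unique⇒Linked-< (x≤y ∷ l) ((x≢y ∷ _) ∷ unique) =
    ℤP.≤∧≢⇒< x≤y x≢y ∷ Linked-≤∧Unique⇒Linked-< l unique

  module Sorting = Data.List.Sort ℤP.≤-decTotalOrder

  sortedImage : ∀ {k} (a : Fin k → ℤ) → Injective _≡_ _≡_ a →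
                Σ (List ℤ) λ ys → Linked _<_ ys × All (InImage a) ys × length ys ≡ k
  sortedImage {k} a a-injective =
    Sorting.sort image ,
    Linked-≤∧Unique⇒Linked-< (Sorting.sort-↗ image) sorted-unique ,
    All.tabulate (λ y∈sorted → inImage (∈-map⁻ a (∈-resp-↭ (Sorting.sort-↭ image) y∈sorted))) ,
    trans (↭-length (Sorting.sort-↭ image))
          (trans (length-map a (allFin k)) (length-tabulate (λ i → i)))
    where
    image : List ℤ
    image = map a (allFin k)
    sorted-unique : Unique (Sorting.sort image)
    sorted-unique = Permutation.Unique-resp-↭ (setoid ℤ) (↭⇒↭ₛ (↭-sym (Sorting.sort-↭ image)))
                      (Unique.map⁺ a-injective (Unique.allFin⁺ k))
    inImage : ∀ {y} → ∃ (λ p → p ∈ allFin k × y ≡ a p) → InImage a y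
    inImage (p , _ , y≡ap) = p , sym y≡ap

  SignedSumset-lowerBound : ∀ h {r} (a : Fin (suc r) → ℤ) → Injective _≡_ _≡_ a →
    Σ (List ℤ) λ L → Unique L × All (SignedSumset h a) L × length L ≡ h ℕ.* r ℕ.+ 1
  SignedSumset-lowerBound h a a-injective
    with y ∷ ys , sorted , ys⊆a , refl ← sortedImage a a-injective
    with L , L-unique , L-length , _ , L⊆Sumset ← sumsetChain h a y ys sorted ys⊆a =
    L , L-unique , All.map (Sumset⇒SignedSumset {a = a}) L⊆Sumset , L-length

  SignedSumset-hasSize : ∀ h {k} (a : Fin k → ℤ) → Σ ℕ λ n → HasSize (SignedSumset h a) n
  SignedSumset-hasSize h a =
    _ , HasSize-filter (SignedSumset? h a) (symRange-unique (h ℕ.* M))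
          (λ x∈S → ∈-symRange⁺ (h ℕ.* M) (SignedSumset-bounded M a (∣a∣≤∑ℕ∣a∣ a) x∈S))
    where
    M = ∑ℕ (λ i → ∣ a i ∣)

  symInterval-injective : ∀ m → Injective _≡_ _≡_ (symInterval m)
  symInterval-injective m {i} {j} eq = Fin.toℕ-injective (ℤP.+-injective (begin
    + toℕ i                ≡⟨ shift (+ toℕ i) (+ m) ⟩
    symInterval m i + + m  ≡⟨ cong (_+ + m) eq ⟩
    symInterval m j + + m  ≡⟨ shift (+ toℕ j) (+ m) ⟨
    + toℕ j                ∎))
    where
    open ≡-Reasoning
    shift : ∀ x y → x ≡ x - y + y
    shift = solve-∀

  symInterval-bounded : ∀ m i → ∣ symInterval m i ∣ ℕ.≤ m
  symInterval-bounded m i with ℕP.≤-total m (toℕ i)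
  ... | inj₁ m≤i = begin
    ∣ symInterval m i ∣  ≡⟨ cong ∣_∣ (trans (ℤP.m-n≡m⊖n (toℕ i) m) (ℤP.⊖-≥ m≤i)) ⟩
    toℕ i ∸ m            ≤⟨ ℕP.m≤n+o⇒m∸n≤o (toℕ i) m (ℕ.s≤s⁻¹ (Fin.toℕ<n i)) ⟩
    m                    ∎
    where open ℕP.≤-Reasoning
  ... | inj₂ i≤m = begin
    ∣ symInterval m i ∣  ≡⟨ trans (cong ∣_∣ (ℤP.m-n≡m⊖n (toℕ i) m)) (ℤP.∣⊖∣-≤ i≤m) ⟩
    m ∸ toℕ i            ≤⟨ ℕP.m∸n≤m m (toℕ i) ⟩
    m                    ∎
    where open ℕP.≤-Reasoning

  *-suc-∸ : ∀ h n → h ℕ.* suc n ∸ h ≡ h ℕ.* n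
  *-suc-∸ h n = trans (cong (_∸ h) (ℕP.*-suc h n)) (ℕP.m+n∸m≡n h (h ℕ.* n))

  SignedSumset-size≥ : ∀ h {r} (a : Fin (suc r) → ℤ) → Injective _≡_ _≡_ a →
    Σ ℕ λ n → HasSize (SignedSumset h a) n × (h ℕ.* suc r ∸ h ℕ.+ 1 ℕ.≤ n)
  SignedSumset-size≥ h {r} a a-injective
    with n , hasSize ← SignedSumset-hasSize h a
    with L , L-unique , L⊆S , L-length ← SignedSumset-lowerBound h a a-injective =
    n , hasSize ,
    subst (ℕ._≤ n) (trans L-length (cong (ℕ._+ 1) (sym (*-suc-∸ h r))))
          (HasSize⇒length≤ hasSize L-unique L⊆S)

  SignedSumset-symInterval : ∀ h m →
    HasSize (SignedSumset h (symInterval m)) (h ℕ.* suc (m ℕ.+ m) ∸ h ℕ.+ 1)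
  SignedSumset-symInterval h m
    with L , L-unique , L⊆S , L-length ←
           SignedSumset-lowerBound h (symInterval m) (symInterval-injective m) =
    subst (HasSize (SignedSumset h a))
          (trans range-length (cong (ℕ._+ 1) (sym (*-suc-∸ h (m ℕ.+ m)))))
      (HasSize-saturated (SignedSumset? h a) (symRange-unique (h ℕ.* m))
        (λ x∈S → ∈-symRange⁺ (h ℕ.* m) (SignedSumset-bounded m a (symInterval-bounded m) x∈S))
        L-unique L⊆S (ℕP.≤-reflexive (trans range-length (sym L-length))))
    where
    a = symInterval m
    range-length : length (symRange (h ℕ.* m)) ≡ h ℕ.* (m ℕ.+ m) ℕ.+ 1
    range-length = begin
      length (symRange (h ℕ.* m))    ≡⟨ length-symRange (h ℕ.* m) ⟩
      suc (h ℕ.* m ℕ.+ h ℕ.* m)      ≡⟨ ℕP.+-comm 1 _ ⟩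
      h ℕ.* m ℕ.+ h ℕ.* m ℕ.+ 1      ≡⟨ cong (ℕ._+ 1) (ℕP.*-distribˡ-+ h m m) ⟨
      h ℕ.* (m ℕ.+ m) ℕ.+ 1          ∎
      where open ≡-Reasoning

open SignedSumsets using (SignedSumset-size≥; SignedSumset-symInterval)

open import Defs
open import Data.Nat using (ℕ; suc; _+_; _*_; _∸_; _≤_)
open import Data.Integer using (ℤ; _<_; +_)
open import Data.Fin using (Fin)
open import Data.Product using (Σ; _×_; ∃; _,_)
open import Function.Definitions using (Injective)
open import Relation.Binary.PropositionalEquality using (_≡_)

theorem7 : ((h k : ℕ) → 1 ≤ h → (a : Fin k → ℤ) → Injective _≡_ _≡_ a →
             (∃ λ i → + 0 < a i) → (∃ λ j → a j < + 0) →
             Σ ℕ λ n → HasSize (SignedSumset h a) n × (h * k ∸ h + 1 ≤ n))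
           × ((h m : ℕ) → 1 ≤ h → 1 ≤ m →
             HasSize (SignedSumset h (symInterval m))
                     (h * suc (m + m) ∸ h + 1))
theorem7 =
  (λ { h 0       _ a _           (() , _) _
     ; h (suc r) _ a a-injective _        _ → SignedSumset-size≥ h a a-injective })
  , (λ h m _ _ → SignedSumset-symInterval h m)
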